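{- Let $\mathbf R=(R,\oplus,\cdot,0,1)$ be a ring-like structure of events (RLSE), and write $x':=x\oplus1$. Then $\mathbf R$ is a Boolean ring (with addition $\oplus$ and multiplication $\cdot$) if and only if $\mathbf R$ is weakly associative, i.e. satisfies $(x\oplus y)\oplus1=x\oplus(y\oplus1)$ for all $x,y$, and satisfies the identity $(xy'\oplus1)(x'y\oplus1)\oplus1= x\oplus y$ for all $x,y\in R$.
   Context: A ring-like structure of events (RLSE) is an algebra $(R,\oplus,\cdot,0,1)$ of type $(2,2,0,0)$ such that $(R,\cdot,1)$ is an idempotent commutative monoid with zero element $0$ (i.e. $x0=0$ for all $x$), satisfying the identities (R1) $x\oplus y= y\oplus x$; (R2) $(xy\oplus1)(x\oplus1)\oplus1= x$; (R3) $((xy\oplus1)x\oplus1)x= xy$; (R4) $xy\oplus(x\oplus1)=(xy\oplus1)x\oplus1$. -}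

module Defs where

open import Level using (Level; suc; _⊔_)
open import Data.Product using (Σ; _×_)
open import Relation.Binary.PropositionalEquality using (_≡_)
open import Algebra.Structures using (IsCommutativeRing)

record IsRLSE {a} {A : Set a} (_⊕_ _·_ : A → A → A) (𝟘 𝟙 : A) : Set a where
  field
    ·-assoc    : ∀ x y z → (x · y) · z ≡ x · (y · z)
    ·-comm     : ∀ x y → x · y ≡ y · x
    ·-identity : ∀ x → x · 𝟙 ≡ x
    ·-idem     : ∀ x → x · x ≡ x
    ·-zero     : ∀ x → x · 𝟘 ≡ 𝟘
    R1 : ∀ x y → x ⊕ y ≡ y ⊕ x
    R2 : ∀ x y → (((x · y) ⊕ 𝟙) · (x ⊕ 𝟙)) ⊕ 𝟙 ≡ x
    R3 : ∀ x y → ((((x · y) ⊕ 𝟙) · x) ⊕ 𝟙) · x ≡ x · y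
    R4 : ∀ x y → (x · y) ⊕ (x ⊕ 𝟙) ≡ (((x · y) ⊕ 𝟙) · x) ⊕ 𝟙

WeaklyAssociative : ∀ {a} {A : Set a} (_⊕_ : A → A → A) (𝟙 : A) → Set a
WeaklyAssociative _⊕_ 𝟙 = ∀ x y → (x ⊕ y) ⊕ 𝟙 ≡ x ⊕ (y ⊕ 𝟙)

-- The additive inverse is not part of the RLSE signature, so we require
-- that some negation operation exists making it a commutative ring.
IsBooleanRing : ∀ {a} {A : Set a} (_⊕_ _·_ : A → A → A) (𝟘 𝟙 : A) → Set a
IsBooleanRing {A = A} _⊕_ _·_ 𝟘 𝟙 =
  Σ (A → A) (λ neg → IsCommutativeRing _≡_ _⊕_ _·_ neg 𝟘 𝟙)
  × (∀ x → x · x ≡ x)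

-- In a Boolean ring x + x = 0, and the identity is a direct computation.
-- Conversely, an RLSE is an orthomodular lattice: x ≤ y iff x·y = x,
-- x′ = x ⊕ 1 is an orthocomplementation by (R2), x ∨ y = (x′·y′)′, and (R3)
-- is the orthomodular law. The identity says x ⊕ y = x·y′ ∨ x′·y; combined
-- with weak associativity it yields x·(x′ ∨ y) = x·y for all x, y, i.e. any
-- two elements commute. An orthomodular lattice in which all elements commute
-- is distributive, hence a Boolean algebra, and ⊕, being its symmetric
-- difference, is the addition of the associated Boolean ring.

module Submission where

open import Defs
open import Algebra.Core using (Op₂)
import Algebra.Definitions as Definitions
open import Algebra.Lattice
  using (IsSemilattice; IsDistributiveLattice; BooleanAlgebra; isBooleanAlgebraʳ)
open import Algebra.Consequences.Propositional
  using (comm∧distrˡ⇒distrʳ; distrib∧absorbs⇒distribˡ)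
open import Algebra.Bundles using (CommutativeRing)
open import Algebra.Structures using (IsCommutativeRing)
import Algebra.Properties.CommutativeSemigroup as CommutativeSemigroupProperties
import Algebra.Properties.Group as GroupProperties
open import Data.Product using (_×_; _,_)
open import Function.Bundles using (_⇔_; mk⇔)
open import Function.Base using (id)
import Algebra.Lattice.Properties.BooleanAlgebra as BooleanAlgebraProperties
import Relation.Binary.Reasoning.Setoid as SetoidReasoning
open import Relation.Binary.PropositionalEquality as ≡ using (_≡_)
import Relation.Binary.Construct.NaturalOrder.Left as NaturalOrder
open import Relation.Binary.Bundles using (Poset)

module BooleanRing {c ℓ} (R : CommutativeRing c ℓ) where

  open CommutativeRing R
  open GroupProperties +-group using (identityʳ-unique)
  open CommutativeSemigroupProperties +-commutativeSemigroup using () renaming (interchange to +-interchange)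
  open CommutativeSemigroupProperties *-commutativeSemigroup using () renaming (interchange to *-interchange)
  open SetoidReasoning setoid

  module _ (*-idem : ∀ x → x * x ≈ x) where

    x+x≈0 : ∀ x → x + x ≈ 0#
    x+x≈0 x = identityʳ-unique (x + x) (x + x) (begin
      (x + x) + (x + x)                  ≈⟨ sym (+-cong x*x+x*x≈x+x x*x+x*x≈x+x) ⟩
      (x * x + x * x) + (x * x + x * x)  ≈⟨ sym (+-cong (distribˡ x x x) (distribˡ x x x)) ⟩
      x * (x + x) + x * (x + x)          ≈⟨ sym (distribʳ (x + x) x x) ⟩
      (x + x) * (x + x)                  ≈⟨ *-idem (x + x) ⟩
      x + x                              ∎)
      where
      x*x+x*x≈x+x : x * x + x * x ≈ x + x
      x*x+x*x≈x+x = +-cong (*-idem x) (*-idem x)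

    x*[x+1]≈0 : ∀ x → x * (x + 1#) ≈ 0#
    x*[x+1]≈0 x = trans (distribˡ x x 1#) (trans (+-cong (*-idem x) (*-identityʳ x)) (x+x≈0 x))

    x+1+1≈x : ∀ x → (x + 1#) + 1# ≈ x
    x+1+1≈x x = trans (+-assoc x 1# 1#) (trans (+-congˡ (x+x≈0 1#)) (+-identityʳ x))

    [x[y+1]+1][[x+1]y+1]+1≈x+y : ∀ x y →
      ((x * (y + 1#)) + 1#) * (((x + 1#) * y) + 1#) + 1# ≈ x + y
    [x[y+1]+1][[x+1]y+1]+1≈x+y x y = begin
      (p + 1#) * (q + 1#) + 1#             ≈⟨ +-congʳ (distribˡ (p + 1#) q 1#) ⟩
      ((p + 1#) * q + (p + 1#) * 1#) + 1#  ≈⟨ +-congʳ (+-cong (distribʳ q p 1#) (*-identityʳ _)) ⟩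
      ((p * q + 1# * q) + (p + 1#)) + 1#   ≈⟨ +-congʳ (+-congʳ (+-cong pq≈0 (*-identityˡ q))) ⟩
      ((0# + q) + (p + 1#)) + 1#           ≈⟨ +-congʳ (+-congʳ (+-identityˡ q)) ⟩
      (q + (p + 1#)) + 1#                  ≈⟨ +-assoc q (p + 1#) 1# ⟩
      q + ((p + 1#) + 1#)                  ≈⟨ +-congˡ (x+1+1≈x p) ⟩
      q + p                                ≈⟨ +-comm q p ⟩
      p + q                                ≈⟨ +-cong p≈xy+x q≈xy+y ⟩
      (x * y + x) + (x * y + y)            ≈⟨ +-interchange (x * y) x (x * y) y ⟩
      (x * y + x * y) + (x + y)            ≈⟨ +-congʳ (x+x≈0 (x * y)) ⟩
      0# + (x + y)                         ≈⟨ +-identityˡ (x + y) ⟩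
      x + y                                ∎
      where
      p q : Carrier
      p = x * (y + 1#)
      q = (x + 1#) * y
      pq≈0 : p * q ≈ 0#
      pq≈0 = begin
        (x * (y + 1#)) * ((x + 1#) * y)  ≈⟨ *-interchange x (y + 1#) (x + 1#) y ⟩
        (x * (x + 1#)) * ((y + 1#) * y)  ≈⟨ *-cong (x*[x+1]≈0 x) (trans (*-comm (y + 1#) y) (x*[x+1]≈0 y)) ⟩
        0# * 0#                          ≈⟨ zeroˡ 0# ⟩
        0#                               ∎
      p≈xy+x : p ≈ x * y + x
      p≈xy+x = trans (distribˡ x y 1#) (+-congˡ (*-identityʳ x))
      q≈xy+y : q ≈ x * y + y
      q≈xy+y = trans (distribʳ y x 1#) (+-congˡ (*-identityˡ y))

module _ {c ℓ} (B : BooleanAlgebra c ℓ) where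
  open BooleanAlgebra B
  open BooleanAlgebraProperties B using (deMorgan₁; ∨-identityˡ; ∨-identityʳ)
  open SetoidReasoning setoid

  [x∨y]∧¬[x∧y]≈[x∧¬y]∨[¬x∧y] : ∀ x y → (x ∨ y) ∧ ¬ (x ∧ y) ≈ (x ∧ ¬ y) ∨ (¬ x ∧ y)
  [x∨y]∧¬[x∧y]≈[x∧¬y]∨[¬x∧y] x y = begin
    (x ∨ y) ∧ ¬ (x ∧ y)                                    ≈⟨ ∧-congˡ (deMorgan₁ x y) ⟩
    (x ∨ y) ∧ (¬ x ∨ ¬ y)                                  ≈⟨ ∧-distribʳ-∨ _ x y ⟩
    (x ∧ (¬ x ∨ ¬ y)) ∨ (y ∧ (¬ x ∨ ¬ y))                  ≈⟨ ∨-cong (∧-distribˡ-∨ x _ _) (∧-distribˡ-∨ y _ _) ⟩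
    ((x ∧ ¬ x) ∨ (x ∧ ¬ y)) ∨ ((y ∧ ¬ x) ∨ (y ∧ ¬ y))      ≈⟨ ∨-cong (∨-congʳ (∧-complementʳ x)) (∨-congˡ (∧-complementʳ y)) ⟩
    (⊥ ∨ (x ∧ ¬ y)) ∨ ((y ∧ ¬ x) ∨ ⊥)                      ≈⟨ ∨-cong (∨-identityˡ _) (∨-identityʳ _) ⟩
    (x ∧ ¬ y) ∨ (y ∧ ¬ x)                                  ≈⟨ ∨-congˡ (∧-comm y (¬ x)) ⟩
    (x ∧ ¬ y) ∨ (¬ x ∧ y)                                  ∎

module RLSEProperties {a} {A : Set a} {_⊕_ _·_ : Op₂ A} {𝟘 𝟙 : A}
  (rlse : IsRLSE _⊕_ _·_ 𝟘 𝟙) where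

  open IsRLSE rlse
  open ≡ using (sym; trans; cong; cong₂; subst; isEquivalence)
  open ≡.≡-Reasoning

  _′ : A → A
  x ′ = x ⊕ 𝟙

  ′-involutive : ∀ x → (x ′) ′ ≡ x
  ′-involutive x = begin
    (x ′) ′                  ≡⟨ cong _′ (sym (·-idem (x ′))) ⟩
    ((x ′) · (x ′)) ′        ≡⟨ cong (λ t → ((t ′) · (x ′)) ′) (sym (·-identity x)) ⟩
    (((x · 𝟙) ′) · (x ′)) ′  ≡⟨ R2 x 𝟙 ⟩
    x                        ∎

  ′-flip : ∀ {x y} → x ′ ≡ y → y ′ ≡ x
  ′-flip {x} e = trans (cong _′ (sym e)) (′-involutive x)

  ′-injective : ∀ {x y} → x ′ ≡ y ′ → x ≡ y
  ′-injective {x} {y} e = trans (sym (′-flip e)) (′-involutive y)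

  𝟘′·x′≡x′ : ∀ x → (𝟘 ′) · (x ′) ≡ x ′
  𝟘′·x′≡x′ x = sym (′-flip (subst (λ t → (((t ′) · (x ′)) ′) ≡ x) (·-zero x) (R2 x 𝟘)))

  𝟘′≡𝟙 : 𝟘 ′ ≡ 𝟙
  𝟘′≡𝟙 = begin
    𝟘 ′                 ≡⟨ sym (·-identity (𝟘 ′)) ⟩
    (𝟘 ′) · 𝟙           ≡⟨ cong ((𝟘 ′) ·_) (sym (′-involutive 𝟙)) ⟩
    (𝟘 ′) · ((𝟙 ′) ′)   ≡⟨ 𝟘′·x′≡x′ (𝟙 ′) ⟩
    (𝟙 ′) ′             ≡⟨ ′-involutive 𝟙 ⟩
    𝟙                   ∎

  x·x′≡𝟘 : ∀ x → x · (x ′) ≡ 𝟘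
  x·x′≡𝟘 x = begin
    x · (x ′)                  ≡⟨ ·-comm x (x ′) ⟩
    (x ′) · x                  ≡⟨ cong (λ t → (t ′) · x) (sym 𝟙·x≡x) ⟩
    ((𝟙 · x) ′) · x            ≡⟨ cong (λ t → (((t · x) ′) · x)) (sym 𝟘′≡𝟙) ⟩
    ((((𝟘 ′) · x) ′) · x)      ≡⟨ cong (λ t → ((((t ′) · x) ′) · x)) (sym (·-zero x)) ⟩
    ((((x · 𝟘) ′) · x) ′) · x  ≡⟨ R3 x 𝟘 ⟩
    x · 𝟘                      ≡⟨ ·-zero x ⟩
    𝟘                          ∎
    where
    𝟙·x≡x : 𝟙 · x ≡ x
    𝟙·x≡x = trans (·-comm 𝟙 x) (·-identity x)

  ·-isSemilattice : IsSemilattice _≡_ _·_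
  ·-isSemilattice = record
    { isBand = record
      { isSemigroup = record
        { isMagma = record { isEquivalence = isEquivalence ; ∙-cong = cong₂ _·_ }
        ; assoc = ·-assoc }
      ; idem = ·-idem }
    ; comm = ·-comm }

  open NaturalOrder _≡_ _·_ public using (_≤_)
  open Poset (NaturalOrder.poset _≡_ _·_ ·-isSemilattice) public
    using () renaming (refl to ≤-refl; trans to ≤-trans; antisym to ≤-antisym)

  x·y≤x : ∀ x y → x · y ≤ x
  x·y≤x = NaturalOrder.x∙y≤x _≡_ _·_ ·-isSemilattice

  x·y≤y : ∀ x y → x · y ≤ y
  x·y≤y = NaturalOrder.x∙y≤y _≡_ _·_ ·-isSemilattice

  ·-greatest : ∀ {x y z} → x ≤ y → x ≤ z → x ≤ y · z
  ·-greatest = NaturalOrder.∙-presʳ-≤ _≡_ _·_ ·-isSemilattice _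

  ·-monoʳ-≤ : ∀ x {y z} → y ≤ z → x · y ≤ x · z
  ·-monoʳ-≤ x {y} y≤z = ·-greatest (x·y≤x x y) (≤-trans (x·y≤y x y) y≤z)

  ′-antitone : ∀ {x y} → x ≤ y → y ′ ≤ x ′
  ′-antitone {x} {y} x≤y =
    trans (′-flip (subst (λ t → ((t ′) · (y ′)) ′ ≡ y) y·x≡x (R2 y x)))
          (·-comm (x ′) (y ′))
    where
    y·x≡x : y · x ≡ x
    y·x≡x = trans (·-comm y x) (sym x≤y)

  _∨_ : Op₂ A
  x ∨ y = ((x ′) · (y ′)) ′

  ∨-comm : ∀ x y → x ∨ y ≡ y ∨ x
  ∨-comm x y = cong _′ (·-comm (x ′) (y ′))

  x≤x∨y : ∀ x y → x ≤ x ∨ y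
  x≤x∨y x y = subst (_≤ x ∨ y) (′-involutive x) (′-antitone (x·y≤x (x ′) (y ′)))

  y≤x∨y : ∀ x y → y ≤ x ∨ y
  y≤x∨y x y = subst (y ≤_) (∨-comm y x) (x≤x∨y y x)

  ∨-least : ∀ {x y z} → x ≤ z → y ≤ z → x ∨ y ≤ z
  ∨-least {x} {y} {z} x≤z y≤z =
    subst (x ∨ y ≤_) (′-involutive z) (′-antitone (·-greatest (′-antitone x≤z) (′-antitone y≤z)))

  ′-· : ∀ x y → (x · y) ′ ≡ (x ′) ∨ (y ′)
  ′-· x y = cong _′ (sym (cong₂ _·_ (′-involutive x) (′-involutive y)))

  ∨-assoc : ∀ x y z → (x ∨ y) ∨ z ≡ x ∨ (y ∨ z)
  ∨-assoc x y z = cong _′ (begin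
    ((x ∨ y) ′) · (z ′)         ≡⟨ cong (_· (z ′)) (′-involutive _) ⟩
    ((x ′) · (y ′)) · (z ′)     ≡⟨ ·-assoc (x ′) (y ′) (z ′) ⟩
    (x ′) · ((y ′) · (z ′))     ≡⟨ cong ((x ′) ·_) (sym (′-involutive _)) ⟩
    (x ′) · ((y ∨ z) ′)         ∎)

  ∨-monoʳ-≤ : ∀ x {y z} → y ≤ z → x ∨ y ≤ x ∨ z
  ∨-monoʳ-≤ x {y} {z} y≤z = ∨-least (x≤x∨y x z) (≤-trans y≤z (y≤x∨y x z))

  ∨-absorbs-· : ∀ x y → x ∨ (x · y) ≡ x
  ∨-absorbs-· x y = ≤-antisym (∨-least ≤-refl (x·y≤x x y)) (x≤x∨y x (x · y))

  ·-absorbs-∨ : ∀ x y → x · (x ∨ y) ≡ x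
  ·-absorbs-∨ x y = sym (x≤x∨y x y)

  orthomodular : ∀ {x y} → y ≤ x → x · ((x ′) ∨ y) ≡ y
  orthomodular {x} {y} y≤x = begin
    x · ((((x ′) ′) · (y ′)) ′)  ≡⟨ cong (λ t → x · ((t · (y ′)) ′)) (′-involutive x) ⟩
    x · ((x · (y ′)) ′)          ≡⟨ ·-comm x _ ⟩
    ((x · (y ′)) ′) · x          ≡⟨ cong (λ t → (t ′) · x) (·-comm x (y ′)) ⟩
    (((y ′) · x) ′) · x          ≡⟨ cong (λ t → (((t ′) · x) ′) · x) (sym x·y≡y) ⟩
    ((((x · y) ′) · x) ′) · x    ≡⟨ R3 x y ⟩
    x · y                        ≡⟨ x·y≡y ⟩
    y                            ∎
    where
    x·y≡y : x · y ≡ y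
    x·y≡y = trans (·-comm x y) (sym y≤x)

module WeaklyAssociativeRLSE {a} {A : Set a} {_⊕_ _·_ : Op₂ A} {𝟘 𝟙 : A}
  (rlse : IsRLSE _⊕_ _·_ 𝟘 𝟙) where

  open IsRLSE rlse
  open RLSEProperties rlse
  open Definitions (_≡_ {A = A}) using (_DistributesOver_; _DistributesOverˡ_)
  open ≡ using (sym; trans; cong; cong₂; subst; isEquivalence)
  open ≡.≡-Reasoning

  -- The second hypothesis unfolds to the identity of the theorem.
  module _ (weaklyAssociative : WeaklyAssociative _⊕_ 𝟙)
           (⊕≡xy′∨x′y : ∀ x y → (x · (y ′)) ∨ ((x ′) · y) ≡ x ⊕ y) where

    [xy′]′·[x′y]′≡xy∨x′y′ : ∀ x y → ((x · (y ′)) ′) · (((x ′) · y) ′) ≡ (x · y) ∨ ((x ′) · (y ′))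
    [xy′]′·[x′y]′≡xy∨x′y′ x y = ′-injective (begin
      (((x · (y ′)) ′) · (((x ′) · y) ′)) ′   ≡⟨ ⊕≡xy′∨x′y x y ⟩
      x ⊕ y                                 ≡⟨ sym (′-involutive (x ⊕ y)) ⟩
      ((x ⊕ y) ′) ′                         ≡⟨ cong _′ (weaklyAssociative x y) ⟩
      (x ⊕ (y ′)) ′                         ≡⟨ cong _′ (sym (⊕≡xy′∨x′y x (y ′))) ⟩
      ((x · ((y ′) ′)) ∨ ((x ′) · (y ′))) ′  ≡⟨ cong (λ t → ((x · t) ∨ ((x ′) · (y ′))) ′) (′-involutive y) ⟩
      ((x · y) ∨ ((x ′) · (y ′))) ′          ∎)

    x·[x′∨y]≡x·y : ∀ x y → x · ((x ′) ∨ y) ≡ x · y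
    x·[x′∨y]≡x·y x y = begin
      x · ((x ′) ∨ y)                          ≡⟨ cong (λ t → x · ((t · (y ′)) ′)) (′-involutive x) ⟩
      x · ((x · (y ′)) ′)                      ≡⟨ cong (_· ((x · (y ′)) ′)) x≤[x′y]′ ⟩
      (x · (((x ′) · y) ′)) · ((x · (y ′)) ′)  ≡⟨ ·-assoc x _ _ ⟩
      x · ((((x ′) · y) ′) · ((x · (y ′)) ′))  ≡⟨ cong (x ·_) (·-comm _ _) ⟩
      x · (((x · (y ′)) ′) · (((x ′) · y) ′))  ≡⟨ cong (x ·_) ([xy′]′·[x′y]′≡xy∨x′y′ x y) ⟩
      x · ((x · y) ∨ ((x ′) · (y ′)))           ≡⟨ ≤-antisym ≤xy xy≤ ⟩
      x · y                                    ∎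
      where
      x≤[x′y]′ : x ≤ ((x ′) · y) ′
      x≤[x′y]′ = subst (_≤ ((x ′) · y) ′) (′-involutive x) (′-antitone (x·y≤x (x ′) y))
      xy∨x′y′≤x′∨xy : (x · y) ∨ ((x ′) · (y ′)) ≤ (x ′) ∨ (x · y)
      xy∨x′y′≤x′∨xy = subst ((x · y) ∨ ((x ′) · (y ′)) ≤_) (∨-comm (x · y) (x ′)) (∨-monoʳ-≤ (x · y) (x·y≤x (x ′) (y ′)))
      ≤xy : x · ((x · y) ∨ ((x ′) · (y ′))) ≤ x · y
      ≤xy = subst (x · ((x · y) ∨ ((x ′) · (y ′))) ≤_) (orthomodular (x·y≤x x y)) (·-monoʳ-≤ x xy∨x′y′≤x′∨xy)
      xy≤ : x · y ≤ x · ((x · y) ∨ ((x ′) · (y ′)))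
      xy≤ = ·-greatest (x·y≤x x y) (x≤x∨y (x · y) ((x ′) · (y ′)))

    z≤x′∨xz : ∀ x z → z ≤ (x ′) ∨ (x · z)
    z≤x′∨xz x z = subst (z ≤_) (cong _′ (sym x′′·[xz]′≡xz′)) z≤[xz′]′
      where
      x′′·[xz]′≡xz′ : ((x ′) ′) · ((x · z) ′) ≡ x · (z ′)
      x′′·[xz]′≡xz′ = trans (cong₂ _·_ (′-involutive x) (′-· x z)) (x·[x′∨y]≡x·y x (z ′))
      z≤[xz′]′ : z ≤ (x · (z ′)) ′
      z≤[xz′]′ = subst (_≤ (x · (z ′)) ′) (′-involutive z) (′-antitone (x·y≤y x (z ′)))

    residuated : ∀ {x y z} → x · z ≤ y → z ≤ (x ′) ∨ y
    residuated {x} {y} {z} xz≤y = ≤-trans (z≤x′∨xz x z) (∨-monoʳ-≤ (x ′) xz≤y)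

    ·-distribˡ-∨ : ∀ x y z → x · (y ∨ z) ≡ (x · y) ∨ (x · z)
    ·-distribˡ-∨ x y z = ≤-antisym ≤xy∨xz xy∨xz≤
      where
      w : A
      w = (x · y) ∨ (x · z)
      ≤xy∨xz : x · (y ∨ z) ≤ w
      ≤xy∨xz = ≤-trans
        (·-monoʳ-≤ x (∨-least (residuated (x≤x∨y (x · y) (x · z))) (residuated (y≤x∨y (x · y) (x · z)))))
        (subst (_≤ w) (sym (x·[x′∨y]≡x·y x w)) (x·y≤y x w))
      xy∨xz≤ : w ≤ x · (y ∨ z)
      xy∨xz≤ = ∨-least (·-monoʳ-≤ x (x≤x∨y y z)) (·-monoʳ-≤ x (y≤x∨y y z))

    ·-∨-isDistributiveLattice : IsDistributiveLattice _≡_ _∨_ _·_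
    ·-∨-isDistributiveLattice = record
      { isLattice = record
        { isEquivalence = isEquivalence
        ; ∨-comm = ∨-comm ; ∨-assoc = ∨-assoc ; ∨-cong = cong₂ _∨_
        ; ∧-comm = ·-comm ; ∧-assoc = ·-assoc ; ∧-cong = cong₂ _·_
        ; absorptive = ∨-absorbs-· , ·-absorbs-∨ }
      ; ∨-distrib-∧ = ∨-distribˡ-· , comm∧distrˡ⇒distrʳ ∨-comm ∨-distribˡ-·
      ; ∧-distrib-∨ = ·-distrib-∨ }
      where
      ·-distrib-∨ : _·_ DistributesOver _∨_
      ·-distrib-∨ = ·-distribˡ-∨ , comm∧distrˡ⇒distrʳ ·-comm ·-distribˡ-∨
      ∨-distribˡ-· : _∨_ DistributesOverˡ _·_
      ∨-distribˡ-· = distrib∧absorbs⇒distribˡ (cong₂ _∨_) ∨-assoc ·-comm ∨-absorbs-· ·-absorbs-∨ ·-distrib-∨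

    booleanAlgebra : BooleanAlgebra a a
    booleanAlgebra = record
      { isBooleanAlgebra = isBooleanAlgebraʳ record
        { isDistributiveLattice = ·-∨-isDistributiveLattice
        ; ∨-complementʳ = λ x → trans (cong _′ (x·x′≡𝟘 (x ′))) 𝟘′≡𝟙
        ; ∧-complementʳ = x·x′≡𝟘
        ; ¬-cong = cong _′ } }

    ⊕-·-isCommutativeRing : IsCommutativeRing _≡_ _⊕_ _·_ id 𝟘 𝟙
    ⊕-·-isCommutativeRing =
      BooleanAlgebraProperties.XorRing.⊕-∧-isCommutativeRing booleanAlgebra _⊕_ ⊕-def
      where
      ⊕-def : ∀ x y → x ⊕ y ≡ (x ∨ y) · ((x · y) ′)
      ⊕-def x y = sym (trans ([x∨y]∧¬[x∧y]≈[x∧¬y]∨[¬x∧y] booleanAlgebra x y) (⊕≡xy′∨x′y x y))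

theorem2p4 : ∀ {a} {A : Set a} (_⊕_ _·_ : A → A → A) (𝟘 𝟙 : A) →
    IsRLSE _⊕_ _·_ 𝟘 𝟙 →
    IsBooleanRing _⊕_ _·_ 𝟘 𝟙 ⇔
      (WeaklyAssociative _⊕_ 𝟙 ×
       (∀ x y → (((x · (y ⊕ 𝟙)) ⊕ 𝟙) · (((x ⊕ 𝟙) · y) ⊕ 𝟙)) ⊕ 𝟙 ≡ x ⊕ y))
theorem2p4 _⊕_ _·_ 𝟘 𝟙 rlse = mk⇔
  (λ { ((_ , isCommutativeRing) , ·-idem) →
       (λ x y → IsCommutativeRing.+-assoc isCommutativeRing x y 𝟙) ,
       BooleanRing.[x[y+1]+1][[x+1]y+1]+1≈x+y (record { isCommutativeRing = isCommutativeRing }) ·-idem })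
  (λ { (weaklyAssociative , ⊕≡xy′∨x′y) →
       (id , WeaklyAssociativeRLSE.⊕-·-isCommutativeRing rlse weaklyAssociative ⊕≡xy′∨x′y) ,
       IsRLSE.·-idem rlse })
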